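{- Let $\Pi=\{0=p_0<p_1<\cdots<p_s=n\}$ be a set of integers and let $\delta_h=p_h-p_{h-1}$ for $1\leqslant h\leqslant s$. Fix $h$ with $1\leqslant h\leqslant s$, and let $w_h$ be a word over a two-letter alphabet $A$ with $\Pi(w_h)=\Pi_h$, where $\Pi_h=\{p-p_h \mid p\in\Pi,\ p\geqslant p_h\}$. If $\delta_h>n-p_h$, then there exists a sequence $a_1,\dots,a_{\delta_h-|w_h|}$ of letters of $A$ such that the word $w_{h-1}=w_h a_1\cdots a_{\delta_h-|w_h|} w_h$ has no period of length smaller than $\delta_h$.
   Context: For a word $u=u_1\cdots u_m$, a positive integer $p$ is a period of $u$ if $u_i=u_{i+p}$ for all $1\leqslant i\leqslant m-p$; $\Pi(u)$ denotes the set of all periods of $u$ that are at most $|u|$, with $0$ included (so $|u|\in\Pi(u)$ and $|u|=\max\Pi(u)$). $|u|$ denotes the length of $u$. -}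

module Defs where

open import Data.Nat using (ℕ; zero; suc; _+_; _∸_; _≤_; _<_)
open import Data.List using (List; []; _∷_; length)
open import Data.Maybe using (Maybe; just; nothing)
open import Data.Product using (Σ; _×_; ∃-syntax)
open import Data.Sum using (_⊎_)
open import Relation.Binary.PropositionalEquality using (_≡_)

_!_ : {A : Set} → List A → ℕ → Maybe A
[]      ! _     = nothing
(x ∷ _) ! zero  = just x
(_ ∷ u) ! suc i = u ! i

IsPeriod : {A : Set} → List A → ℕ → Set
IsPeriod u q = ∀ i → i + q < length u → u ! i ≡ u ! (i + q)

InPi : {A : Set} → List A → ℕ → Set
InPi u q = (q ≡ 0) ⊎ ((1 ≤ q) × (q ≤ length u) × IsPeriod u q)

-- The set Π = {p 0 < p 1 < ... < p s}, given by a function p on indices 0..s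
StrictlyIncreasingUpTo : (s : ℕ) → (ℕ → ℕ) → Set
StrictlyIncreasingUpTo s p = ∀ i j → i < j → j ≤ s → p i < p j

InPiShift : (s : ℕ) → (ℕ → ℕ) → ℕ → ℕ → Set
InPiShift s p h q = ∃[ j ] (j ≤ s × p h ≤ p j × q ≡ p j ∸ p h)

-- For nonempty w let B
-- be the length of its longest proper border and z = w_B the letter following it, and
-- fill the gap of length k = δ_h − |w| with yᵏ, where y ≠ z.  A period q < |w| + k of
-- w yᵏ w satisfies q ≤ k + B, since q = k + t with t > B would make t a longer border
-- of w.  Following q back from the z at position |w| + k + B then reaches a y: directly
-- inside the gap when q > B, and through the border and position |w| when q ≤ B.
-- For empty w the filler cᵏ⁻¹d works.
module Submission where

open import Defs
open import Data.Nat using (ℕ; zero; suc; _+_; _∸_; _≤_; _<_; z≤n; s≤s; s≤s⁻¹)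
open import Data.Nat.Properties hiding (_≟_)
open import Data.Nat.Tactic.RingSolver using (solve-∀)
open import Data.Fin using (Fin; opposite)
import Data.Fin.Properties as Finₚ
open import Data.List using (List; []; _∷_; [_]; length; _++_; _∷ʳ_; replicate)
open import Data.List.Properties using (length-++; length-replicate; ++-identityʳ)
open import Data.Maybe using (just)
open import Data.Maybe.Properties using (just-injective) renaming (≡-dec to ≡-decMaybe)
open import Data.Product using (_×_; ∃; ∃-syntax; _,_)
open import Data.Sum using (inj₁; inj₂)
open import Data.Empty using (⊥-elim)
open import Function.Bundles using (_↔_; Inverse)
open import Function.Properties.Inverse using (↔⇒↣)
open import Relation.Binary.Definitions using (DecidableEquality)
open import Relation.Binary.PropositionalEquality
  using (_≡_; _≢_; refl; sym; trans; cong; subst; subst₂; module ≡-Reasoning)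
open import Relation.Nullary using (¬_; Dec; yes; no)
open import Relation.Nullary.Decidable using (via-injection)
open import Relation.Unary using (Decidable)

module _ {A : Set} where

  !-++ˡ : (xs ys : List A) {i : ℕ} → i < length xs → (xs ++ ys) ! i ≡ xs ! i
  !-++ˡ (x ∷ xs) ys {zero}  _         = refl
  !-++ˡ (x ∷ xs) ys {suc i} (s≤s i<n) = !-++ˡ xs ys i<n

  !-++ʳ : (xs ys : List A) (i : ℕ) → (xs ++ ys) ! (length xs + i) ≡ ys ! i
  !-++ʳ []       ys i = refl
  !-++ʳ (x ∷ xs) ys i = !-++ʳ xs ys i

  !-replicate : (k : ℕ) (y : A) {i : ℕ} → i < k → replicate k y ! i ≡ just y
  !-replicate (suc k) y {zero}  _         = refl
  !-replicate (suc k) y {suc i} (s≤s i<k) = !-replicate k y i<k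

  !-defined : (xs : List A) {i : ℕ} → i < length xs → ∃ λ x → xs ! i ≡ just x
  !-defined (x ∷ xs) {zero}  _         = x , refl
  !-defined (x ∷ xs) {suc i} (s≤s i<n) = !-defined xs i<n

  IsPeriod-≡ : (u : List A) {q i j : ℕ} → IsPeriod u q → i + q ≡ j → j < length u → u ! i ≡ u ! j
  IsPeriod-≡ u per refl j<|u| = per _ j<|u|

  NoPeriodBelow : List A → ℕ → Set
  NoPeriodBelow u d = ∀ q → 1 ≤ q → q < d → ¬ IsPeriod u q

  Border : List A → ℕ → Set
  Border w b = ∀ {i} → i < b → w ! i ≡ w ! (length w ∸ b + i)

  border? : DecidableEquality A → (w : List A) (b : ℕ) → Dec (Border w b)
  border? _≟_ w b = allUpTo? (λ i → ≡-decMaybe _≟_ (w ! i) (w ! (length w ∸ b + i))) b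

largest≤ : {P : ℕ → Set} → Decidable P → P 0 → (n : ℕ) →
  ∃ λ b → b ≤ n × P b × (∀ {t} → t ≤ n → P t → t ≤ b)
largest≤ P? P0 zero = 0 , z≤n , P0 , λ { z≤n _ → z≤n }
largest≤ P? P0 (suc n) with P? (suc n)
... | yes P1+n = suc n , ≤-refl , P1+n , λ t≤1+n _ → t≤1+n
... | no ¬P1+n with largest≤ P? P0 n
... | b , b≤n , Pb , maximal =
  b , m≤n⇒m≤1+n b≤n , Pb ,
  λ t≤1+n Pt → maximal (s≤s⁻¹ (≤∧≢⇒< t≤1+n λ { refl → ¬P1+n Pt })) Pt

module PaddedWord {A : Set} (w : List A) (k : ℕ) (y : A) where

  m : ℕ
  m = length w

  u : List A
  u = w ++ replicate k y ++ w

  length-u : length u ≡ m + (k + m)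
  length-u = begin
    length u                                ≡⟨ length-++ w ⟩
    m + length (replicate k y ++ w)         ≡⟨ cong (m +_) (length-++ (replicate k y)) ⟩
    m + (length (replicate k y) + m)        ≡⟨ cong (λ l → m + (l + m)) (length-replicate k) ⟩
    m + (k + m)                             ∎
    where open ≡-Reasoning

  u!-left : ∀ {i} → i < m → u ! i ≡ w ! i
  u!-left = !-++ˡ w _

  u!-middle : ∀ {j} → j < k → u ! (m + j) ≡ just y
  u!-middle {j} j<k = begin
    u ! (m + j)                     ≡⟨ !-++ʳ w _ j ⟩
    (replicate k y ++ w) ! j        ≡⟨ !-++ˡ (replicate k y) w (subst (j <_) (sym (length-replicate k)) j<k) ⟩
    replicate k y ! j               ≡⟨ !-replicate k y j<k ⟩
    just y                          ∎
    where open ≡-Reasoning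

  u!-right : ∀ i → u ! (m + (k + i)) ≡ w ! i
  u!-right i = begin
    u ! (m + (k + i))                                    ≡⟨ !-++ʳ w _ (k + i) ⟩
    (replicate k y ++ w) ! (k + i)                       ≡⟨ cong (λ l → (replicate k y ++ w) ! (l + i))
                                                                  (sym (length-replicate k)) ⟩
    (replicate k y ++ w) ! (length (replicate k y) + i)  ≡⟨ !-++ʳ (replicate k y) w i ⟩
    w ! i                                                ∎
    where open ≡-Reasoning

  right<length-u : ∀ {i} → i < m → m + (k + i) < length u
  right<length-u i<m = subst (_ <_) (sym length-u) (+-monoʳ-< m (+-monoʳ-< k i<m))

  long-period⇒border : ∀ {q t} → IsPeriod u q → k + t ≡ q → t ≤ m → Border w t
  long-period⇒border {q} {t} per k+t≡q t≤m {i} i<t = sym (begin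
    w ! (e + i)        ≡⟨ sym (u!-left e+i<m) ⟩
    u ! (e + i)        ≡⟨ IsPeriod-≡ u per shift (right<length-u (<-≤-trans i<t t≤m)) ⟩
    u ! (m + (k + i))  ≡⟨ u!-right i ⟩
    w ! i              ∎)
    where
    open ≡-Reasoning
    e : ℕ
    e = m ∸ t
    e+t≡m : e + t ≡ m
    e+t≡m = m∸n+n≡m t≤m
    e+i<m : e + i < m
    e+i<m = subst (e + i <_) e+t≡m (+-monoʳ-< e i<t)
    shift : e + i + q ≡ m + (k + i)
    shift = begin
      e + i + q        ≡⟨ cong (e + i +_) (sym k+t≡q) ⟩
      e + i + (k + t)  ≡⟨ swap e i k t ⟩
      e + t + (k + i)  ≡⟨ cong (_+ (k + i)) e+t≡m ⟩
      m + (k + i)      ∎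
      where
      swap : ∀ a b c d → a + b + (c + d) ≡ a + d + (c + b)
      swap = solve-∀

  module _ {B : ℕ} (B<m : B < m) (border : Border w B)
           (longest : ∀ {t} → t < m → Border w t → t ≤ B)
           (1≤k : 1 ≤ k) {q : ℕ} (1≤q : 1 ≤ q) (q<m+k : q < m + k) (per : IsPeriod u q) where

    period≤gap+border : q ≤ k + B
    period≤gap+border with ≤-total q k
    ... | inj₁ q≤k = ≤-trans q≤k (m≤m+n k B)
    ... | inj₂ k≤q with m≤n⇒∃[o]m+o≡n k≤q
    ... | t , k+t≡q =
      subst (_≤ k + B) k+t≡q (+-monoʳ-≤ k (longest t<m (long-period⇒border per k+t≡q (<⇒≤ t<m))))
      where
      t<m : t < m
      t<m = +-cancelˡ-< k t m (subst₂ _<_ (sym k+t≡q) (+-comm m k) q<m+k)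

    letter-after-border-via-gap : B < q → w ! B ≡ just y
    letter-after-border-via-gap B<q with m≤n⇒∃[o]m+o≡n period≤gap+border
    ... | j , q+j≡k+B = begin
      w ! B              ≡⟨ sym (u!-right B) ⟩
      u ! (m + (k + B))  ≡⟨ sym (IsPeriod-≡ u per shift (right<length-u B<m)) ⟩
      u ! (m + j)        ≡⟨ u!-middle j<k ⟩
      just y             ∎
      where
      open ≡-Reasoning
      j<k : j < k
      j<k = +-cancelʳ-< B j k (subst (j + B <_) (trans (+-comm j q) q+j≡k+B) (+-monoʳ-< j B<q))
      shift : m + j + q ≡ m + (k + B)
      shift = trans (+-assoc m j q) (cong (m +_) (trans (+-comm j q) q+j≡k+B))

    letter-after-border-via-border : q ≤ B → w ! B ≡ just y
    letter-after-border-via-border q≤B with m≤n⇒∃[o]m+o≡n q≤B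
    ... | r , q+r≡B = begin
      w ! B              ≡⟨ sym (u!-right B) ⟩
      u ! (m + (k + B))  ≡⟨ sym (IsPeriod-≡ u per shiftʳ (right<length-u B<m)) ⟩
      u ! (m + (k + r))  ≡⟨ u!-right r ⟩
      w ! r              ≡⟨ border r<B ⟩
      w ! (e + r)        ≡⟨ sym (u!-left e+r<m) ⟩
      u ! (e + r)        ≡⟨ IsPeriod-≡ u per shiftˡ m<length-u ⟩
      u ! m              ≡⟨ cong (u !_) (sym (+-identityʳ m)) ⟩
      u ! (m + 0)        ≡⟨ u!-middle 1≤k ⟩
      just y             ∎
      where
      open ≡-Reasoning
      r+q≡B : r + q ≡ B
      r+q≡B = trans (+-comm r q) q+r≡B
      e : ℕ
      e = m ∸ B
      e+B≡m : e + B ≡ m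
      e+B≡m = m∸n+n≡m (<⇒≤ B<m)
      r<B : r < B
      r<B = subst (r <_) r+q≡B (m<m+n r 1≤q)
      e+r<m : e + r < m
      e+r<m = subst (e + r <_) e+B≡m (+-monoʳ-< e r<B)
      shiftʳ : m + (k + r) + q ≡ m + (k + B)
      shiftʳ = trans (+-assoc m (k + r) q) (cong (m +_) (trans (+-assoc k r q) (cong (k +_) r+q≡B)))
      shiftˡ : e + r + q ≡ m
      shiftˡ = trans (+-assoc e r q) (trans (cong (e +_) r+q≡B) e+B≡m)
      m<length-u : m < length u
      m<length-u = subst (m <_) (sym length-u) (m<m+n m (≤-trans 1≤k (m≤m+n k m)))

    letter-after-border : w ! B ≡ just y
    letter-after-border with ≤-<-connex q B
    ... | inj₁ q≤B = letter-after-border-via-border q≤B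
    ... | inj₂ B<q = letter-after-border-via-gap B<q

length-replicate-∷ʳ : {A : Set} (k : ℕ) (c d : A) → length (replicate k c ∷ʳ d) ≡ suc k
length-replicate-∷ʳ k c d = trans (length-++ (replicate k c)) (trans (cong (_+ 1) (length-replicate k)) (+-comm k 1))

replicate-∷ʳ-noPeriodBelow : {A : Set} {c d : A} → c ≢ d → (k : ℕ) →
  NoPeriodBelow (replicate k c ∷ʳ d) (suc k)
replicate-∷ʳ-noPeriodBelow {A} {c} {d} c≢d k q 1≤q (s≤s q≤k) per with m≤n⇒∃[o]m+o≡n q≤k
... | j , q+j≡k = c≢d (just-injective (begin
  just c             ≡⟨ sym (!-replicate k c j<k) ⟩
  replicate k c ! j  ≡⟨ sym (!-++ˡ (replicate k c) [ d ] (subst (j <_) (sym (length-replicate k)) j<k)) ⟩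
  a ! j              ≡⟨ IsPeriod-≡ a per j+q≡k (subst (k <_) (sym (length-replicate-∷ʳ k c d)) ≤-refl) ⟩
  a ! k              ≡⟨ cong (a !_) (sym (trans (+-identityʳ _) (length-replicate k))) ⟩
  a ! (length (replicate k c) + 0) ≡⟨ !-++ʳ (replicate k c) [ d ] 0 ⟩
  just d             ∎))
  where
  open ≡-Reasoning
  a : List A
  a = replicate k c ∷ʳ d
  j+q≡k : j + q ≡ k
  j+q≡k = trans (+-comm j q) q+j≡k
  j<k : j < k
  j<k = subst (j <_) j+q≡k (m<m+n j 1≤q)

module BinaryAlphabet {A : Set} (A↔2 : A ↔ Fin 2) where
  open Inverse A↔2

  _≟_ : DecidableEquality A
  _≟_ = via-injection (↔⇒↣ A↔2) Finₚ._≟_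

  other : A → A
  other x = from (opposite (to x))

  other-≢ : ∀ x → other x ≢ x
  other-≢ x other-x≡x = opposite-≢ (to x) (trans (sym (strictlyInverseˡ _)) (cong to other-x≡x))
    where
    opposite-≢ : (i : Fin 2) → opposite i ≢ i
    opposite-≢ Fin.zero ()
    opposite-≢ (Fin.suc Fin.zero) ()

aperiodic-filler : {A : Set} → A ↔ Fin 2 → (w : List A) (k : ℕ) → 1 ≤ k →
  ∃[ a ] (length a ≡ k × NoPeriodBelow (w ++ a ++ w) (length w + k))
aperiodic-filler {A} A↔2 [] (suc k) _ =
  replicate k c ∷ʳ d , length-replicate-∷ʳ k c d ,
  subst (λ v → NoPeriodBelow v (suc k)) (sym (++-identityʳ (replicate k c ∷ʳ d)))
    (replicate-∷ʳ-noPeriodBelow (λ c≡d → other-≢ c (sym c≡d)) k)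
  where
  open BinaryAlphabet A↔2
  c d : A
  c = Inverse.from A↔2 Fin.zero
  d = other c
aperiodic-filler A↔2 w@(_ ∷ xs) k 1≤k
  with largest≤ (border? (BinaryAlphabet._≟_ A↔2) w) (λ ()) (length xs)
... | B , B≤|xs| , border , longest with !-defined w (s≤s B≤|xs|)
... | z , w!B≡z =
  replicate k (other z) , length-replicate k ,
  λ q 1≤q q<m+k per → other-≢ z (just-injective (trans (sym (forced q 1≤q q<m+k per)) w!B≡z))
  where
  open BinaryAlphabet A↔2
  forced : ∀ q → 1 ≤ q → q < length w + k →
    IsPeriod (w ++ replicate k (other z) ++ w) q → w ! B ≡ just (other z)
  forced q 1≤q q<m+k per = PaddedWord.letter-after-border w k (other z)
    (s≤s B≤|xs|) border (λ t<m → longest (s≤s⁻¹ t<m)) 1≤k 1≤q q<m+k per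

aperiodic-completion : {A : Set} → A ↔ Fin 2 → (w : List A) {δ : ℕ} → length w < δ →
  ∃[ a ] (length a ≡ δ ∸ length w × NoPeriodBelow (w ++ a ++ w) δ)
aperiodic-completion A↔2 w {δ} |w|<δ
  with aperiodic-filler A↔2 w (δ ∸ length w) (m<n⇒0<n∸m |w|<δ)
... | a , |a|≡δ-|w| , aperiodic =
  a , |a|≡δ-|w| , subst (NoPeriodBelow (w ++ a ++ w)) (m+[n∸m]≡n (<⇒≤ |w|<δ)) aperiodic

length∈Π : {A : Set} (w : List A) → InPi w (length w)
length∈Π []        = inj₁ refl
length∈Π w@(_ ∷ _) = inj₂ (s≤s z≤n , ≤-refl , λ i i+m<m → ⊥-elim (m+n≮n i (length w) i+m<m))

increasing⇒≤last : {s : ℕ} {p : ℕ → ℕ} → StrictlyIncreasingUpTo s p → ∀ {j} → j ≤ s → p j ≤ p s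
increasing⇒≤last {s} inc {j} j≤s with m≤n⇒m<n∨m≡n j≤s
... | inj₁ j<s  = <⇒≤ (inc j s j<s ≤-refl)
... | inj₂ refl = ≤-refl

InPiShift⇒≤ : {s n : ℕ} {p : ℕ → ℕ} → p s ≡ n → StrictlyIncreasingUpTo s p →
  ∀ {h q} → InPiShift s p h q → q ≤ n ∸ p h
InPiShift⇒≤ {p = p} refl inc {h} (j , j≤s , _ , refl) = ∸-monoˡ-≤ (p h) (increasing⇒≤last inc j≤s)

lemma1 : (A : Set) → A ↔ Fin 2 →
    (s n : ℕ) (p : ℕ → ℕ) →
    p 0 ≡ 0 → p s ≡ n → StrictlyIncreasingUpTo s p →
    (h : ℕ) → 1 ≤ h → h ≤ s →
    (w : List A) → (∀ q → InPi w q → InPiShift s p h q) → (∀ q → InPiShift s p h q → InPi w q) →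
    n ∸ p h < p h ∸ p (h ∸ 1) →
    ∃[ a ] (length a ≡ (p h ∸ p (h ∸ 1)) ∸ length w ×
      (∀ q → 1 ≤ q → q < p h ∸ p (h ∸ 1) → ¬ IsPeriod (w ++ a ++ w) q))
lemma1 A A↔2 s n p _ pₛ≡n inc h _ _ w Πw⊆Πₕ _ tail<δ =
  aperiodic-completion A↔2 w (≤-<-trans |w|≤tail tail<δ)
  where
  |w|≤tail : length w ≤ n ∸ p h
  |w|≤tail = InPiShift⇒≤ pₛ≡n inc (Πw⊆Πₕ (length w) (length∈Π w))
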